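{- Let $n\ge 2$ and let $q$ be an indeterminate. Then $$\sum_{\sigma\in B_n} q^{\operatorname{neg}\sigma}x^{\operatorname{des}_D\sigma}\;=\;\sum_{\mathbf{e}\in I_n} q^{\operatorname{exc}\mathbf{e}}x^{\operatorname{asc}_D\mathbf{e}},$$ where all notation is as in the context.
   Context: $B_n$ is the set of signed permutations of $[n]$, i.e. bijections $\sigma$ of $\{\pm1,\dots,\pm n\}$ with $\sigma(-i)=-\sigma(i)$, written in one-line notation $(\sigma_1,\dots,\sigma_n)$ with $\sigma_i=\sigma(i)$. $\operatorname{neg}\sigma$ is the number of negative entries among $\sigma_1,\dots,\sigma_n$. $\operatorname{Des}_D\sigma=\{0:\text{if }\sigma_1+\sigma_2<0\}\cup\{i\in[n-1]:\sigma_i>\sigma_{i+1}\}$ and $\operatorname{des}_D\sigma=|\operatorname{Des}_D\sigma|$. $I_n$ is the set of sequences $\mathbf e=(e_1,\dots,e_n)$ of integers with $0\le e_i<2i$ for each $i$. For $\mathbf e\in I_n$: $\operatorname{exc}\mathbf e=\#\{i\in[n]: e_i\ge i\}$; $\operatorname{Asc}_D\mathbf e=\{i\in[n-1]: e_i/i<e_{i+1}/(i+1)\}\cup\{0:\text{if } e_1+e_2/2\ge 3/2\}$ and $\operatorname{asc}_D\mathbf e=|\operatorname{Asc}_D\mathbf e|$. -}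

module Defs where

open import Data.Nat as ℕ using (ℕ; zero; suc; _+_; _*_; _<_; _≤_)
open import Data.Integer as ℤ using (ℤ; +_; -[1+_]; ∣_∣)
open import Data.List using (List; []; _∷_; map; concatMap; length; filter; upTo; _++_)
open import Data.List.Relation.Unary.Unique.DecPropositional ℕ._≟_ using (Unique; unique?)
open import Data.Product using (_×_)
open import Relation.Nullary.Decidable using (_×-dec_)

⟦_⟧ : ∀ {p} {P : Set p} → Relation.Nullary.Decidable.Dec P → ℕ
⟦ Relation.Nullary.Decidable.yes _ ⟧ = 1
⟦ Relation.Nullary.Decidable.no _ ⟧ = 0

-- Signed permutations B_n, in one-line notation (σ₁,…,σₙ) as a list of
-- integers: each σᵢ ∈ {±1,…,±n} and the absolute values |σᵢ| are distinct
-- (hence form a permutation of [n]).  The bijection σ of ±[n] is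
-- determined by its one-line notation via σ(-i) = -σ(i).

signedVals : ℕ → List ℤ
signedVals n = concatMap (λ k → (+ suc k) ∷ -[1+ k ] ∷ []) (upTo n)

words : {A : Set} → ℕ → List A → List (List A)
words zero    _  = [] ∷ []
words (suc m) xs = concatMap (λ w → map (λ x → x ∷ w) xs) (words m xs)

IsSignedPerm : List ℤ → Set
IsSignedPerm σ = Unique (map ∣_∣ σ)

B : ℕ → List (List ℤ)
B n = filter (λ σ → unique? (map ∣_∣ σ)) (words n (signedVals n))

neg : List ℤ → ℕ
neg []       = 0
neg (x ∷ xs) = ⟦ x ℤ.<? + 0 ⟧ + neg xs

desTypeA : List ℤ → ℕ
desTypeA []           = 0
desTypeA (x ∷ [])     = 0
desTypeA (x ∷ y ∷ xs) = ⟦ y ℤ.<? x ⟧ + desTypeA (y ∷ xs)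

desD : List ℤ → ℕ
desD []           = 0
desD (x ∷ [])     = 0
desD (x ∷ y ∷ xs) = ⟦ (x ℤ.+ y) ℤ.<? + 0 ⟧ + desTypeA (x ∷ y ∷ xs)

-- I n lists the sequences as lists [e₁, …, eₙ]
I : ℕ → List (List ℕ)
I zero    = [] ∷ []
I (suc n) = concatMap (λ e → map (λ k → e ++ (k ∷ [])) (upTo (2 * suc n))) (I n)

-- exc e = #{i : eᵢ ≥ i}; the head of the list has index i
excFrom : ℕ → List ℕ → ℕ
excFrom i []       = 0
excFrom i (x ∷ xs) = ⟦ i ℕ.≤? x ⟧ + excFrom (suc i) xs

exc : List ℕ → ℕ
exc = excFrom 1

-- #{i ∈ [n-1] : eᵢ/i < eᵢ₊₁/(i+1)}, where the head has index i.
-- eᵢ/i < eᵢ₊₁/(i+1)  ⇔  eᵢ·(i+1) < eᵢ₊₁·i   (i ≥ 1)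
ascFrom : ℕ → List ℕ → ℕ
ascFrom i []           = 0
ascFrom i (x ∷ [])     = 0
ascFrom i (x ∷ y ∷ xs) = ⟦ x * suc i ℕ.<? y * i ⟧ + ascFrom (suc i) (y ∷ xs)

-- asc_D e = [e₁ + e₂/2 ≥ 3/2] + #{i ∈ [n-1] : eᵢ/i < eᵢ₊₁/(i+1)}
-- e₁ + e₂/2 ≥ 3/2  ⇔  2e₁ + e₂ ≥ 3
ascD : List ℕ → ℕ
ascD []           = 0
ascD (x ∷ [])     = 0
ascD (x ∷ y ∷ xs) = ⟦ 3 ℕ.≤? 2 * x + y ⟧ + ascFrom 1 (x ∷ y ∷ xs)

-- Coefficients of the generating polynomials in ℤ[q,x]:
-- [q^a x^b] Σ_{σ∈B_n} q^{neg σ} x^{des_D σ}   and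
-- [q^a x^b] Σ_{e∈I_n} q^{exc e} x^{asc_D e}.

coeffB : ℕ → ℕ → ℕ → ℕ
coeffB n a b = length (filter (λ σ → (neg σ ℕ.≟ a) ×-dec (desD σ ℕ.≟ b)) (B n))

coeffI : ℕ → ℕ → ℕ → ℕ
coeffI n a b = length (filter (λ e → (exc e ℕ.≟ a) ×-dec (ascD e ℕ.≟ b)) (I n))

-- Refine both generating polynomials by their last entry: e_n for e ∈ I_n, and code n σ_n ∈ [0, 2n)
-- for σ ∈ B_n. Appending e_{n+1} to e adds [e_{n+1} ≥ n + 1] to exc and [e_n/n < e_{n+1}/(n+1)] to
-- asc_D. A signed permutation of [n+1] with last entry v is a signed permutation τ of [n], renumbered
-- to avoid |v|, followed by v; this adds [v < 0] to neg and [v < σ_n] to des_D, and under the encoding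
-- v ↦ code (n+1) v these are exactly the two indicators above. Hence both refined sums obey the same
-- recursion in n, and they agree for n = 2 by inspection.

module Submission where

open import Defs
open import Data.Nat as ℕ using (ℕ; zero; suc; _+_; _*_; _∸_; _≤_; _<_; z≤n; s≤s)
open import Data.Nat.Properties as ℕₚ using (+-assoc; +-comm; +-identityʳ; *-identityʳ)
open import Data.Nat.Tactic.RingSolver using (solve-∀)
open import Data.Integer as ℤ using (ℤ; -[1+_]; ∣_∣; +<+; -<+; -<-) renaming (+_ to ⁺_)
import Data.Integer.Properties as ℤₚ
open import Data.List using (List; []; _∷_; _++_; _∷ʳ_; map; concatMap; length; filter; upTo)
import Data.List.Properties as Listₚ
open import Data.List.Relation.Unary.All as All using (All; []; _∷_; all?)
import Data.List.Relation.Unary.All.Properties as Allₚ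
open import Data.List.Relation.Unary.AllPairs using ([]; _∷_)
open import Data.List.Relation.Unary.Unique.DecPropositional ℕ._≟_ using (Unique; unique?)
import Data.List.Relation.Unary.Unique.Propositional.Properties as Uniqueₚ
open import Data.Product using (_×_; _,_; map₂)
open import Data.Empty using (⊥-elim)
open import Function using (_∘_)
open import Level using (0ℓ)
open import Function.Bundles using (_⇔_; mk⇔; Equivalence)
open import Function.Construct.Composition using (_⇔-∘_)
open import Function.Construct.Symmetry using (⇔-sym)
open import Relation.Nullary using (Dec; yes; no; ¬_)
open import Relation.Nullary.Decidable using (_×-dec_; ¬?)
open import Relation.Unary using (Pred; Decidable)
open import Relation.Binary.PropositionalEquality
open import Relation.Binary.Definitions using (tri<; tri≈; tri>)

⟦⟧≡1 : {P : Set} (d : Dec P) → P → ⟦ d ⟧ ≡ 1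
⟦⟧≡1 (yes _) _  = refl
⟦⟧≡1 (no ¬p) p = ⊥-elim (¬p p)

⟦⟧≡0 : {P : Set} (d : Dec P) → ¬ P → ⟦ d ⟧ ≡ 0
⟦⟧≡0 (yes p) ¬p = ⊥-elim (¬p p)
⟦⟧≡0 (no _)  _  = refl

⟦⟧-cong : {P Q : Set} (d : Dec P) (e : Dec Q) → P ⇔ Q → ⟦ d ⟧ ≡ ⟦ e ⟧
⟦⟧-cong (yes p) e P⇔Q = sym (⟦⟧≡1 e (Equivalence.to P⇔Q p))
⟦⟧-cong (no ¬p) e P⇔Q = sym (⟦⟧≡0 e (¬p ∘ Equivalence.from P⇔Q))

⟦×-dec⟧ : {P Q : Set} (d : Dec P) (e : Dec Q) → ⟦ d ×-dec e ⟧ ≡ ⟦ d ⟧ * ⟦ e ⟧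
⟦×-dec⟧ (yes _) (yes _) = refl
⟦×-dec⟧ (yes _) (no _)  = refl
⟦×-dec⟧ (no _)  (yes _) = refl
⟦×-dec⟧ (no _)  (no _)  = refl

⟦all?⟧-∷ : {A : Set} {P : Pred A 0ℓ} (P? : Decidable P) (x : A) (xs : List A) →
           ⟦ all? P? (x ∷ xs) ⟧ ≡ ⟦ P? x ⟧ * ⟦ all? P? xs ⟧
⟦all?⟧-∷ P? x xs =
  trans (⟦⟧-cong (all? P? (x ∷ xs)) (P? x ×-dec all? P? xs) (mk⇔ All.uncons (λ (p , ps) → p ∷ ps)))
        (⟦×-dec⟧ (P? x) (all? P? xs))

-- Finite sums over lists

∑ : {A : Set} → (A → ℕ) → List A → ℕ
∑ f []       = 0
∑ f (x ∷ xs) = f x + ∑ f xs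

module _ {A : Set} where

  ∑-++ : (f : A → ℕ) (xs ys : List A) → ∑ f (xs ++ ys) ≡ ∑ f xs + ∑ f ys
  ∑-++ f []       ys = refl
  ∑-++ f (x ∷ xs) ys = trans (cong (f x +_) (∑-++ f xs ys)) (sym (+-assoc (f x) _ _))

  ∑-∷ʳ : (f : A → ℕ) (xs : List A) (y : A) → ∑ f (xs ∷ʳ y) ≡ ∑ f xs + f y
  ∑-∷ʳ f xs y = trans (∑-++ f xs (y ∷ [])) (cong (∑ f xs +_) (+-identityʳ (f y)))

  ∑-cong : {f g : A → ℕ} (xs : List A) → (∀ x → f x ≡ g x) → ∑ f xs ≡ ∑ g xs
  ∑-cong []       f≗g = refl
  ∑-cong (x ∷ xs) f≗g = cong₂ _+_ (f≗g x) (∑-cong xs f≗g)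

  ∑-cong-All : {P : Pred A 0ℓ} {f g : A → ℕ} {xs : List A} →
               All P xs → (∀ x → P x → f x ≡ g x) → ∑ f xs ≡ ∑ g xs
  ∑-cong-All []         f≗g = refl
  ∑-cong-All (px ∷ pxs) f≗g = cong₂ _+_ (f≗g _ px) (∑-cong-All pxs f≗g)

  ∑-zero : (xs : List A) → ∑ (λ _ → 0) xs ≡ 0
  ∑-zero []       = refl
  ∑-zero (x ∷ xs) = ∑-zero xs

  ∑-+ : (f g : A → ℕ) (xs : List A) → ∑ (λ x → f x + g x) xs ≡ ∑ f xs + ∑ g xs
  ∑-+ f g []       = refl
  ∑-+ f g (x ∷ xs) rewrite ∑-+ f g xs = interchange (f x) (g x) (∑ f xs) (∑ g xs)
    where
    interchange : ∀ a b c d → a + b + (c + d) ≡ a + c + (b + d)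
    interchange = solve-∀

  ∑-*ˡ : (c : ℕ) (f : A → ℕ) (xs : List A) → ∑ (λ x → c * f x) xs ≡ c * ∑ f xs
  ∑-*ˡ c f []       = sym (ℕₚ.*-zeroʳ c)
  ∑-*ˡ c f (x ∷ xs) rewrite ∑-*ˡ c f xs = sym (ℕₚ.*-distribˡ-+ c (f x) (∑ f xs))

  ∑-filter : {P : Pred A 0ℓ} (P? : Decidable P) (f : A → ℕ) (xs : List A) →
             ∑ f (filter P? xs) ≡ ∑ (λ x → ⟦ P? x ⟧ * f x) xs
  ∑-filter P? f []       = refl
  ∑-filter P? f (x ∷ xs) with P? x
  ... | yes _ = cong₂ _+_ (sym (+-identityʳ (f x))) (∑-filter P? f xs)
  ... | no _  = ∑-filter P? f xs

  length≡∑1 : (xs : List A) → length xs ≡ ∑ (λ _ → 1) xs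
  length≡∑1 []       = refl
  length≡∑1 (x ∷ xs) = cong suc (length≡∑1 xs)

module _ {A B : Set} where

  ∑-concatMap : (f : B → ℕ) (g : A → List B) (xs : List A) →
                ∑ f (concatMap g xs) ≡ ∑ (λ x → ∑ f (g x)) xs
  ∑-concatMap f g []       = refl
  ∑-concatMap f g (x ∷ xs) =
    trans (∑-++ f (g x) (concatMap g xs)) (cong (∑ f (g x) +_) (∑-concatMap f g xs))

  ∑-map : (f : B → ℕ) (g : A → B) (xs : List A) → ∑ f (map g xs) ≡ ∑ (f ∘ g) xs
  ∑-map f g []       = refl
  ∑-map f g (x ∷ xs) = cong (f (g x) +_) (∑-map f g xs)

  ∑-comm : (h : A → B → ℕ) (xs : List A) (ys : List B) →
           ∑ (λ x → ∑ (h x) ys) xs ≡ ∑ (λ y → ∑ (λ x → h x y) xs) ys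
  ∑-comm h []       ys = sym (∑-zero ys)
  ∑-comm h (x ∷ xs) ys = trans (cong (∑ (h x) ys +_) (∑-comm h xs ys))
                               (sym (∑-+ (h x) (λ y → ∑ (λ x′ → h x′ y) xs) ys))

module _ {A : Set} where

  ∑-words-suc : (f : List A → ℕ) (m : ℕ) (xs : List A) →
                ∑ f (words (suc m) xs) ≡ ∑ (λ w → ∑ (λ x → f (x ∷ w)) xs) (words m xs)
  ∑-words-suc f m xs =
    trans (∑-concatMap f (λ w → map (_∷ w) xs) (words m xs))
          (∑-cong (words m xs) (λ w → ∑-map f (_∷ w) xs))

  ∑-words-∷ʳ : (m : ℕ) (f : List A → ℕ) (xs : List A) →
               ∑ f (words (suc m) xs) ≡ ∑ (λ w → ∑ (λ x → f (w ∷ʳ x)) xs) (words m xs)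
  ∑-words-∷ʳ zero    f xs = ∑-words-suc f 0 xs
  ∑-words-∷ʳ (suc m) f xs = begin
    ∑ f (words (suc (suc m)) xs)
      ≡⟨ ∑-words-suc f (suc m) xs ⟩
    ∑ (λ w → ∑ (λ x → f (x ∷ w)) xs) (words (suc m) xs)
      ≡⟨ ∑-words-∷ʳ m (λ w → ∑ (λ x → f (x ∷ w)) xs) xs ⟩
    ∑ (λ w → ∑ (λ y → ∑ (λ x → f (x ∷ w ∷ʳ y)) xs) xs) (words m xs)
      ≡⟨ ∑-cong (words m xs) (λ w → ∑-comm (λ y x → f (x ∷ w ∷ʳ y)) xs xs) ⟩
    ∑ (λ w → ∑ (λ x → ∑ (λ y → f (x ∷ w ∷ʳ y)) xs) xs) (words m xs)
      ≡⟨ ∑-words-suc (λ w → ∑ (λ y → f (w ∷ʳ y)) xs) m xs ⟨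
    ∑ (λ w → ∑ (λ y → f (w ∷ʳ y)) xs) (words (suc m) xs) ∎
    where open ≡-Reasoning

  ∑-words-filter : {P : Pred A 0ℓ} (P? : Decidable P) (m : ℕ) (f : List A → ℕ) (xs : List A) →
                   ∑ (λ w → ⟦ all? P? w ⟧ * f w) (words m xs) ≡ ∑ f (words m (filter P? xs))
  ∑-words-filter P? zero    f xs = cong (_+ 0) (+-identityʳ (f []))
  ∑-words-filter P? (suc m) f xs = begin
    ∑ (λ w → ⟦ all? P? w ⟧ * f w) (words (suc m) xs)
      ≡⟨ ∑-words-suc (λ w → ⟦ all? P? w ⟧ * f w) m xs ⟩
    ∑ (λ w → ∑ (λ x → ⟦ all? P? (x ∷ w) ⟧ * f (x ∷ w)) xs) (words m xs)
      ≡⟨ ∑-cong (words m xs) restrict ⟩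
    ∑ (λ w → ⟦ all? P? w ⟧ * ∑ (λ x → f (x ∷ w)) (filter P? xs)) (words m xs)
      ≡⟨ ∑-words-filter P? m (λ w → ∑ (λ x → f (x ∷ w)) (filter P? xs)) xs ⟩
    ∑ (λ w → ∑ (λ x → f (x ∷ w)) (filter P? xs)) (words m (filter P? xs))
      ≡⟨ ∑-words-suc f m (filter P? xs) ⟨
    ∑ f (words (suc m) (filter P? xs)) ∎
    where
    open ≡-Reasoning
    reassoc : ∀ p a b → p * a * b ≡ a * (p * b)
    reassoc = solve-∀
    restrict : ∀ w → ∑ (λ x → ⟦ all? P? (x ∷ w) ⟧ * f (x ∷ w)) xs ≡
                     ⟦ all? P? w ⟧ * ∑ (λ x → f (x ∷ w)) (filter P? xs)
    restrict w = begin
      ∑ (λ x → ⟦ all? P? (x ∷ w) ⟧ * f (x ∷ w)) xs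
        ≡⟨ ∑-cong xs (λ x → cong (_* f (x ∷ w)) (⟦all?⟧-∷ P? x w)) ⟩
      ∑ (λ x → ⟦ P? x ⟧ * ⟦ all? P? w ⟧ * f (x ∷ w)) xs
        ≡⟨ ∑-cong xs (λ x → reassoc ⟦ P? x ⟧ ⟦ all? P? w ⟧ (f (x ∷ w))) ⟩
      ∑ (λ x → ⟦ all? P? w ⟧ * (⟦ P? x ⟧ * f (x ∷ w))) xs
        ≡⟨ ∑-*ˡ ⟦ all? P? w ⟧ (λ x → ⟦ P? x ⟧ * f (x ∷ w)) xs ⟩
      ⟦ all? P? w ⟧ * ∑ (λ x → ⟦ P? x ⟧ * f (x ∷ w)) xs
        ≡⟨ cong (⟦ all? P? w ⟧ *_) (∑-filter P? (λ x → f (x ∷ w)) xs) ⟨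
      ⟦ all? P? w ⟧ * ∑ (λ x → f (x ∷ w)) (filter P? xs) ∎

  ∑-words-cong-All : {P : Pred A 0ℓ} {xs : List A} → All P xs → (m : ℕ) {f g : List A → ℕ} →
                     (∀ w → All P w → length w ≡ m → f w ≡ g w) →
                     ∑ f (words m xs) ≡ ∑ g (words m xs)
  ∑-words-cong-All pxs zero    f≗g = cong (_+ 0) (f≗g [] [] refl)
  ∑-words-cong-All {xs = xs} pxs (suc m) {f} {g} f≗g =
    trans (∑-words-suc f m xs)
   (trans (∑-words-cong-All pxs m (λ w pw ∣w∣≡m →
             ∑-cong-All pxs (λ x px → f≗g (x ∷ w) (px ∷ pw) (cong suc ∣w∣≡m))))
          (sym (∑-words-suc g m xs)))

module _ {A B : Set} where

  ∑-words-map : (m : ℕ) (f : List B → ℕ) (g : A → B) (xs : List A) →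
                ∑ f (words m (map g xs)) ≡ ∑ (f ∘ map g) (words m xs)
  ∑-words-map zero    f g xs = refl
  ∑-words-map (suc m) f g xs =
    trans (∑-words-suc f m (map g xs))
   (trans (∑-words-map m (λ w → ∑ (λ x → f (x ∷ w)) (map g xs)) g xs)
   (trans (∑-cong (words m xs) (λ w → ∑-map (λ x → f (x ∷ map g w)) g xs))
          (sym (∑-words-suc (f ∘ map g) m xs))))

∑-I-suc : (n : ℕ) (f : List ℕ → ℕ) →
          ∑ f (I (suc n)) ≡ ∑ (λ e → ∑ (λ k → f (e ∷ʳ k)) (upTo (2 * suc n))) (I n)
∑-I-suc n f = trans (∑-concatMap f _ (I n))
                    (∑-cong (I n) (λ e → ∑-map f (e ∷ʳ_) (upTo (2 * suc n))))

∑-I-cong : (n : ℕ) {f g : List ℕ → ℕ} → (∀ e → length e ≡ n → f e ≡ g e) → ∑ f (I n) ≡ ∑ g (I n)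
∑-I-cong zero    f≗g = cong (_+ 0) (f≗g [] refl)
∑-I-cong (suc n) {f} {g} f≗g =
  trans (∑-I-suc n f)
 (trans (∑-I-cong n (λ e ∣e∣≡n → ∑-cong (upTo (2 * suc n)) (λ k → f≗g (e ∷ʳ k)
           (trans (Listₚ.length-++ e) (trans (+-comm (length e) 1) (cong suc ∣e∣≡n))))))
        (sym (∑-I-suc n g)))

Unique-∷ʳ : (xs : List ℕ) (c : ℕ) → Unique (xs ∷ʳ c) ⇔ (Unique xs × All (λ x → c ≢ x) xs)
Unique-∷ʳ xs c = mk⇔ (to xs) (from xs)
  where
  to : ∀ xs → Unique (xs ∷ʳ c) → Unique xs × All (λ x → c ≢ x) xs
  to []       _          = [] , []
  to (x ∷ xs) (x∉ ∷ uxs) with Allₚ.∷ʳ⁻ x∉ | to xs uxs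
  ... | x∉xs , x≢c | uxs′ , c∉xs = (x∉xs ∷ uxs′) , (x≢c ∘ sym) ∷ c∉xs
  from : ∀ xs → Unique xs × All (λ x → c ≢ x) xs → Unique (xs ∷ʳ c)
  from []       _                           = [] ∷ []
  from (x ∷ xs) ((x∉xs ∷ uxs) , (c≢x ∷ c∉xs)) = Allₚ.∷ʳ⁺ x∉xs (c≢x ∘ sym) ∷ from xs (uxs , c∉xs)

avoids? : (c : ℕ) → Decidable (λ (x : ℤ) → c ≢ ∣ x ∣)
avoids? c x = ¬? (c ℕ.≟ ∣ x ∣)

isSignedPerm? : (σ : List ℤ) → Dec (IsSignedPerm σ)
isSignedPerm? σ = unique? (map ∣_∣ σ)

IsSignedPerm-∷ʳ : (w : List ℤ) (v : ℤ) → IsSignedPerm (w ∷ʳ v) ⇔ (IsSignedPerm w × All (λ x → ∣ v ∣ ≢ ∣ x ∣) w)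
IsSignedPerm-∷ʳ w v rewrite Listₚ.map-++ ∣_∣ w (v ∷ []) =
  mk⇔ (map₂ Allₚ.map⁻ ∘ to) (from ∘ map₂ Allₚ.map⁺)
  where open Equivalence (Unique-∷ʳ (map ∣_∣ w) ∣ v ∣)

⟦isSignedPerm?⟧-∷ʳ : (w : List ℤ) (v : ℤ) →
                     ⟦ isSignedPerm? (w ∷ʳ v) ⟧ ≡ ⟦ isSignedPerm? w ⟧ * ⟦ all? (avoids? ∣ v ∣) w ⟧
⟦isSignedPerm?⟧-∷ʳ w v =
  trans (⟦⟧-cong (isSignedPerm? (w ∷ʳ v)) (isSignedPerm? w ×-dec all? (avoids? ∣ v ∣) w) (IsSignedPerm-∷ʳ w v))
        (⟦×-dec⟧ (isSignedPerm? w) (all? (avoids? ∣ v ∣) w))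

⟦unique?⟧-map : {f : ℕ → ℕ} → (∀ {a b} → f a ≡ f b → a ≡ b) → (xs : List ℕ) →
                ⟦ unique? (map f xs) ⟧ ≡ ⟦ unique? xs ⟧
⟦unique?⟧-map f-inj xs = ⟦⟧-cong (unique? (map _ xs)) (unique? xs) (mk⇔ Uniqueₚ.map⁻ (Uniqueₚ.map⁺ f-inj))

-- Signed values and punching in a new absolute value

signedValsʳ : ℕ → List ℤ
signedValsʳ zero    = []
signedValsʳ (suc n) = signedValsʳ n ++ (⁺ suc n ∷ -[1+ n ] ∷ [])

signedVals≡signedValsʳ : (n : ℕ) → signedVals n ≡ signedValsʳ n
signedVals≡signedValsʳ zero    = refl
signedVals≡signedValsʳ (suc n) =
  trans (cong (concatMap ±suc) (sym (Listₚ.upTo-∷ʳ n)))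
 (trans (Listₚ.concatMap-++ ±suc (upTo n) (n ∷ []))
        (cong (_++ ±suc n) (signedVals≡signedValsʳ n)))
  where
  ±suc : ℕ → List ℤ
  ±suc k = ⁺ suc k ∷ -[1+ k ] ∷ []

data Signed (n : ℕ) : ℤ → Set where
  pos    : ∀ {k} → k < n → Signed n (⁺ suc k)
  negsuc : ∀ {k} → k < n → Signed n -[1+ k ]

Signed-suc : ∀ {n x} → Signed n x → Signed (suc n) x
Signed-suc (pos k<n)    = pos (ℕₚ.m≤n⇒m≤1+n k<n)
Signed-suc (negsuc k<n) = negsuc (ℕₚ.m≤n⇒m≤1+n k<n)

All-Signed-signedValsʳ : (n : ℕ) → All (Signed n) (signedValsʳ n)
All-Signed-signedValsʳ zero    = []
All-Signed-signedValsʳ (suc n) =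
  Allₚ.++⁺ (All.map Signed-suc (All-Signed-signedValsʳ n)) (pos ℕₚ.≤-refl ∷ negsuc ℕₚ.≤-refl ∷ [])

punchIn : ℕ → ℕ → ℕ
punchIn k a = ⟦ k ℕ.≤? a ⟧ + a

punchIn-< : ∀ {k a} → a < k → punchIn k a ≡ a
punchIn-< {k} {a} a<k = cong (_+ a) (⟦⟧≡0 (k ℕ.≤? a) (ℕₚ.<⇒≱ a<k))

punchIn-≥ : ∀ {k a} → k ≤ a → punchIn k a ≡ suc a
punchIn-≥ {k} {a} k≤a = cong (_+ a) (⟦⟧≡1 (k ℕ.≤? a) k≤a)

punchIn-mono-< : ∀ k {a b} → a < b → punchIn k a < punchIn k b
punchIn-mono-< k {a} {b} a<b with k ℕ.≤? a | k ℕ.≤? b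
... | yes _   | yes _   = s≤s a<b
... | no _    | no _    = a<b
... | no _    | yes _   = ℕₚ.m≤n⇒m≤1+n a<b
... | yes k≤a | no k≰b  = ⊥-elim (k≰b (ℕₚ.≤-trans k≤a (ℕₚ.<⇒≤ a<b)))

punchIn-cancel-< : ∀ k {a b} → punchIn k a < punchIn k b → a < b
punchIn-cancel-< k {a} {b} lt with ℕₚ.<-cmp a b
... | tri< a<b _ _    = a<b
... | tri≈ _ refl _   = ⊥-elim (ℕₚ.<-irrefl refl lt)
... | tri> _ _ b<a    = ⊥-elim (ℕₚ.<-asym lt (punchIn-mono-< k b<a))

punchIn-injective : ∀ k {a b} → punchIn k a ≡ punchIn k b → a ≡ b
punchIn-injective k {a} {b} eq with ℕₚ.<-cmp a b
... | tri< a<b _ _ = ⊥-elim (ℕₚ.<⇒≢ (punchIn-mono-< k a<b) eq)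
... | tri≈ _ a≡b _ = a≡b
... | tri> _ _ b<a = ⊥-elim (ℕₚ.<⇒≢ (punchIn-mono-< k b<a) (sym eq))

punchIn-suc : ∀ k a → suc (punchIn k a) ≡ punchIn (suc k) (suc a)
punchIn-suc k a = trans (sym (ℕₚ.+-suc ⟦ k ℕ.≤? a ⟧ a))
  (cong (_+ suc a) (⟦⟧-cong (k ℕ.≤? a) (suc k ℕ.≤? suc a) (mk⇔ s≤s ℕₚ.≤-pred)))

-- The inverse of standardisation: renumbers ±[n] as ±([n+1] \ {k+1}), keeping signs.
punchInℤ : ℕ → ℤ → ℤ
punchInℤ k (⁺ zero)  = ⁺ zero
punchInℤ k (⁺ suc a) = ⁺ suc (punchIn k a)
punchInℤ k -[1+ a ]  = -[1+ punchIn k a ]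

punchInℤ-neg : ∀ k x → punchInℤ k (ℤ.- x) ≡ ℤ.- punchInℤ k x
punchInℤ-neg k (⁺ zero)  = refl
punchInℤ-neg k (⁺ suc a) = refl
punchInℤ-neg k -[1+ a ]  = refl

∣punchInℤ∣ : ∀ k x → ∣ punchInℤ k x ∣ ≡ punchIn (suc k) ∣ x ∣
∣punchInℤ∣ k (⁺ zero)  = refl
∣punchInℤ∣ k (⁺ suc a) = punchIn-suc k a
∣punchInℤ∣ k -[1+ a ]  = punchIn-suc k a

punchInℤ-mono-< : ∀ k {x y} → x ℤ.< y → punchInℤ k x ℤ.< punchInℤ k y
punchInℤ-mono-< k {⁺ zero}   {⁺ suc b}  (+<+ _)       = +<+ (s≤s z≤n)
punchInℤ-mono-< k {⁺ suc a}  {⁺ suc b}  (+<+ (s≤s p)) = +<+ (s≤s (punchIn-mono-< k p))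
punchInℤ-mono-< k { -[1+ a ]} {⁺ zero}  -<+           = -<+
punchInℤ-mono-< k { -[1+ a ]} {⁺ suc b} -<+           = -<+
punchInℤ-mono-< k { -[1+ a ]} { -[1+ b ]} (-<- p)     = -<- (punchIn-mono-< k p)

punchInℤ-cancel-< : ∀ k {x y} → punchInℤ k x ℤ.< punchInℤ k y → x ℤ.< y
punchInℤ-cancel-< k {⁺ zero}   {⁺ suc b}  (+<+ _)       = +<+ (s≤s z≤n)
punchInℤ-cancel-< k {⁺ suc a}  {⁺ suc b}  (+<+ (s≤s p)) = +<+ (s≤s (punchIn-cancel-< k p))
punchInℤ-cancel-< k { -[1+ a ]} {⁺ zero}  -<+           = -<+
punchInℤ-cancel-< k { -[1+ a ]} {⁺ suc b} -<+           = -<+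
punchInℤ-cancel-< k { -[1+ a ]} { -[1+ b ]} (-<- p)     = -<- (punchIn-cancel-< k p)
punchInℤ-cancel-< k {⁺ zero}   {⁺ zero}   (+<+ ())
punchInℤ-cancel-< k {⁺ suc a}  {⁺ zero}   (+<+ ())

punchInℤ-<⇔ : ∀ k {x y} → (x ℤ.< y) ⇔ (punchInℤ k x ℤ.< punchInℤ k y)
punchInℤ-<⇔ k = mk⇔ (punchInℤ-mono-< k) (punchInℤ-cancel-< k)

⟦<⟧-punchInℤ : ∀ k x y → ⟦ x ℤ.<? y ⟧ ≡ ⟦ punchInℤ k x ℤ.<? punchInℤ k y ⟧
⟦<⟧-punchInℤ k x y = ⟦⟧-cong (x ℤ.<? y) _ (punchInℤ-<⇔ k)

+<0⇔<- : ∀ x y → (x ℤ.+ y ℤ.< ⁺ 0) ⇔ (x ℤ.< ℤ.- y)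
+<0⇔<- x y =
  mk⇔ (λ x+y<0 → subst₂ ℤ._<_ x+y-y≡x (ℤₚ.+-identityˡ (ℤ.- y)) (ℤₚ.+-monoˡ-< (ℤ.- y) x+y<0))
      (λ x<-y → subst (x ℤ.+ y ℤ.<_) (ℤₚ.+-inverseˡ y) (ℤₚ.+-monoˡ-< y x<-y))
  where
  x+y-y≡x : x ℤ.+ y ℤ.- y ≡ x
  x+y-y≡x = trans (ℤₚ.+-assoc x y (ℤ.- y))
                  (trans (cong (λ z → x ℤ.+ z) (ℤₚ.+-inverseʳ y)) (ℤₚ.+-identityʳ x))

-- x + y < 0 means x < -y, and punchInℤ is monotone and odd.
⟦+<0⟧-punchInℤ : ∀ k x y → ⟦ (x ℤ.+ y) ℤ.<? ⁺ 0 ⟧ ≡ ⟦ (punchInℤ k x ℤ.+ punchInℤ k y) ℤ.<? ⁺ 0 ⟧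
⟦+<0⟧-punchInℤ k x y = ⟦⟧-cong (_ ℤ.<? ⁺ 0) (_ ℤ.<? ⁺ 0)
  (⇔-sym (+<0⇔<- _ _)
    ⇔-∘ (subst (λ t → (x ℤ.< ℤ.- y) ⇔ (punchInℤ k x ℤ.< t)) (punchInℤ-neg k y) (punchInℤ-<⇔ k)
    ⇔-∘ +<0⇔<- x y))

neg-punchInℤ : ∀ k w → neg (map (punchInℤ k) w) ≡ neg w
neg-punchInℤ k []      = refl
neg-punchInℤ k (x ∷ w) = cong₂ _+_ (sym (⟦<⟧-punchInℤ k x (⁺ 0))) (neg-punchInℤ k w)

desTypeA-punchInℤ : ∀ k w → desTypeA (map (punchInℤ k) w) ≡ desTypeA w
desTypeA-punchInℤ k []          = refl
desTypeA-punchInℤ k (x ∷ [])    = refl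
desTypeA-punchInℤ k (x ∷ y ∷ w) = cong₂ _+_ (sym (⟦<⟧-punchInℤ k y x)) (desTypeA-punchInℤ k (y ∷ w))

desD-punchInℤ : ∀ k w → desD (map (punchInℤ k) w) ≡ desD w
desD-punchInℤ k []          = refl
desD-punchInℤ k (x ∷ [])    = refl
desD-punchInℤ k (x ∷ y ∷ w) = cong₂ _+_ (sym (⟦+<0⟧-punchInℤ k x y)) (desTypeA-punchInℤ k (x ∷ y ∷ w))

⟦isSignedPerm?⟧-punchInℤ : ∀ k w → ⟦ isSignedPerm? (map (punchInℤ k) w) ⟧ ≡ ⟦ isSignedPerm? w ⟧
⟦isSignedPerm?⟧-punchInℤ k w = begin
  ⟦ unique? (map ∣_∣ (map (punchInℤ k) w)) ⟧
    ≡⟨ cong (⟦_⟧ ∘ unique?) (sym (Listₚ.map-∘ w)) ⟩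
  ⟦ unique? (map (∣_∣ ∘ punchInℤ k) w) ⟧
    ≡⟨ cong (⟦_⟧ ∘ unique?) (Listₚ.map-cong (∣punchInℤ∣ k) w) ⟩
  ⟦ unique? (map (punchIn (suc k) ∘ ∣_∣) w) ⟧
    ≡⟨ cong (⟦_⟧ ∘ unique?) (Listₚ.map-∘ w) ⟩
  ⟦ unique? (map (punchIn (suc k)) (map ∣_∣ w)) ⟧
    ≡⟨ ⟦unique?⟧-map (punchIn-injective (suc k)) (map ∣_∣ w) ⟩
  ⟦ unique? (map ∣_∣ w) ⟧ ∎
  where open ≡-Reasoning

filter-avoids-Signed : ∀ n {xs} → All (Signed n) xs → filter (avoids? (suc n)) xs ≡ xs
filter-avoids-Signed n = Listₚ.filter-all (avoids? (suc n)) ∘ All.map avoids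
  where
  avoids : ∀ {x} → Signed n x → suc n ≢ ∣ x ∣
  avoids (pos k<n)    eq = ℕₚ.<-irrefl (ℕₚ.suc-injective (sym eq)) k<n
  avoids (negsuc k<n) eq = ℕₚ.<-irrefl (ℕₚ.suc-injective (sym eq)) k<n

map-punchInℤ-Signed : ∀ k {xs} → All (Signed k) xs → map (punchInℤ k) xs ≡ xs
map-punchInℤ-Signed k []                = refl
map-punchInℤ-Signed k (pos a<k ∷ sxs)    = cong₂ _∷_ (cong (⁺_ ∘ suc) (punchIn-< a<k)) (map-punchInℤ-Signed k sxs)
map-punchInℤ-Signed k (negsuc a<k ∷ sxs) = cong₂ _∷_ (cong -[1+_] (punchIn-< a<k)) (map-punchInℤ-Signed k sxs)

filter-avoids-signedValsʳ : ∀ n k → k ≤ n →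
                            filter (avoids? (suc k)) (signedValsʳ (suc n)) ≡ map (punchInℤ k) (signedValsʳ n)
filter-avoids-signedValsʳ n k k≤n with k ℕ.≟ n
... | yes refl =
  trans (Listₚ.filter-++ (avoids? (suc k)) (signedValsʳ k) (⁺ suc k ∷ -[1+ k ] ∷ []))
 (trans (cong₂ _++_ (filter-avoids-Signed k (All-Signed-signedValsʳ k))
           (trans (Listₚ.filter-reject (avoids? (suc k)) {x = ⁺ suc k} (λ k+1≢k+1 → k+1≢k+1 refl))
                  (Listₚ.filter-reject (avoids? (suc k)) {x = -[1+ k ]} (λ k+1≢k+1 → k+1≢k+1 refl))))
 (trans (Listₚ.++-identityʳ (signedValsʳ k))
        (sym (map-punchInℤ-Signed k (All-Signed-signedValsʳ k)))))
filter-avoids-signedValsʳ zero    k k≤n | no k≢n = ⊥-elim (k≢n (ℕₚ.n≤0⇒n≡0 k≤n))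
filter-avoids-signedValsʳ (suc n) k k≤n | no k≢n =
  trans (Listₚ.filter-++ (avoids? (suc k)) (signedValsʳ (suc n)) (⁺ suc (suc n) ∷ -[1+ suc n ] ∷ []))
 (trans (cong₂ _++_ (filter-avoids-signedValsʳ n k k≤n′)
           (trans (Listₚ.filter-accept (avoids? (suc k)) {x = ⁺ suc (suc n)} (k≢n ∘ ℕₚ.suc-injective))
                  (cong (⁺ suc (suc n) ∷_)
                        (Listₚ.filter-accept (avoids? (suc k)) {x = -[1+ suc n ]} (k≢n ∘ ℕₚ.suc-injective)))))
        (sym (trans (Listₚ.map-++ (punchInℤ k) (signedValsʳ n) (⁺ suc n ∷ -[1+ n ] ∷ []))
                    (cong (map (punchInℤ k) (signedValsʳ n) ++_)
                          (cong₂ (λ a b → ⁺ suc a ∷ -[1+ b ] ∷ []) (punchIn-≥ k≤n′) (punchIn-≥ k≤n′))))))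
  where
  k≤n′ : k ≤ n
  k≤n′ = ℕₚ.≤-pred (ℕₚ.≤∧≢⇒< k≤n k≢n)

-- Appending a last entry

lastOr : {A : Set} → A → List A → A
lastOr d []       = d
lastOr d (x ∷ xs) = lastOr x xs

module _ {A : Set} where

  lastOr-∷ʳ : (d : A) (xs : List A) (y : A) → lastOr d (xs ∷ʳ y) ≡ y
  lastOr-∷ʳ d []       y = refl
  lastOr-∷ʳ d (x ∷ xs) y = lastOr-∷ʳ x xs y

  lastOr-All : {P : Pred A 0ℓ} {d : A} {xs : List A} → P d → All P xs → P (lastOr d xs)
  lastOr-All pd []         = pd
  lastOr-All pd (px ∷ pxs) = lastOr-All px pxs

  lastOr-map : {B : Set} (f : A → B) (d : A) (xs : List A) → lastOr (f d) (map f xs) ≡ f (lastOr d xs)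
  lastOr-map f d []       = refl
  lastOr-map f d (x ∷ xs) = lastOr-map f x xs

neg-∷ʳ : ∀ w v → neg (w ∷ʳ v) ≡ neg w + ⟦ v ℤ.<? ⁺ 0 ⟧
neg-∷ʳ []      v = +-identityʳ _
neg-∷ʳ (x ∷ w) v = trans (cong (⟦ x ℤ.<? ⁺ 0 ⟧ +_) (neg-∷ʳ w v)) (sym (+-assoc ⟦ x ℤ.<? ⁺ 0 ⟧ _ _))

desTypeA-∷ʳ : ∀ x w v → desTypeA ((x ∷ w) ∷ʳ v) ≡ desTypeA (x ∷ w) + ⟦ v ℤ.<? lastOr x w ⟧
desTypeA-∷ʳ x []      v = +-identityʳ _
desTypeA-∷ʳ x (y ∷ w) v =
  trans (cong (⟦ y ℤ.<? x ⟧ +_) (desTypeA-∷ʳ y w v)) (sym (+-assoc ⟦ y ℤ.<? x ⟧ _ _))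

desD-∷ʳ : ∀ x y w v → desD ((x ∷ y ∷ w) ∷ʳ v) ≡ desD (x ∷ y ∷ w) + ⟦ v ℤ.<? lastOr (⁺ 0) (x ∷ y ∷ w) ⟧
desD-∷ʳ x y w v =
  trans (cong (⟦ (x ℤ.+ y) ℤ.<? ⁺ 0 ⟧ +_) (desTypeA-∷ʳ x (y ∷ w) v))
        (sym (+-assoc ⟦ (x ℤ.+ y) ℤ.<? ⁺ 0 ⟧ _ _))

excFrom-∷ʳ : ∀ i e j → excFrom i (e ∷ʳ j) ≡ excFrom i e + ⟦ i + length e ℕ.≤? j ⟧
excFrom-∷ʳ i []      j rewrite +-identityʳ i = +-identityʳ _
excFrom-∷ʳ i (x ∷ e) j rewrite excFrom-∷ʳ (suc i) e j | ℕₚ.+-suc i (length e) =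
  sym (+-assoc ⟦ i ℕ.≤? x ⟧ _ _)

ascFrom-∷ʳ : ∀ i x e j → ascFrom i ((x ∷ e) ∷ʳ j) ≡
             ascFrom i (x ∷ e) + ⟦ lastOr x e * suc (i + length e) ℕ.<? j * (i + length e) ⟧
ascFrom-∷ʳ i x []      j rewrite +-identityʳ i = +-identityʳ _
ascFrom-∷ʳ i x (y ∷ e) j rewrite ascFrom-∷ʳ (suc i) y e j | ℕₚ.+-suc i (length e) =
  sym (+-assoc ⟦ x * suc i ℕ.<? y * i ⟧ _ _)

ascD-∷ʳ : ∀ x y e j → ascD ((x ∷ y ∷ e) ∷ʳ j) ≡
          ascD (x ∷ y ∷ e) + ⟦ lastOr 0 (x ∷ y ∷ e) * suc (length (x ∷ y ∷ e)) ℕ.<? j * length (x ∷ y ∷ e) ⟧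
ascD-∷ʳ x y e j =
  trans (cong (⟦ 3 ℕ.≤? 2 * x + y ⟧ +_) (ascFrom-∷ʳ 1 x (y ∷ e) j)) (sym (+-assoc ⟦ 3 ℕ.≤? 2 * x + y ⟧ _ _))

-- The bijection ±[n] → [0, 2n) sending k ↦ n − k and −k ↦ n + k − 1.
code : ℕ → ℤ → ℕ
code n (⁺ zero)  = 0
code n (⁺ suc i) = n ∸ suc i
code n -[1+ i ]  = n + i

∑-upTo-suc : ∀ m (f : ℕ → ℕ) → ∑ f (upTo (suc m)) ≡ f 0 + ∑ (f ∘ suc) (upTo m)
∑-upTo-suc m f = cong (f 0 +_) (trans (cong (∑ f) (sym (Listₚ.map-upTo suc m))) (∑-map f suc (upTo m)))

∑-upTo-∷ʳ : ∀ m (f : ℕ → ℕ) → ∑ f (upTo (suc m)) ≡ ∑ f (upTo m) + f m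
∑-upTo-∷ʳ m f = trans (cong (∑ f) (sym (Listₚ.upTo-∷ʳ m))) (∑-∷ʳ f (upTo m) m)

∑-upTo-reverse : ∀ m (f : ℕ → ℕ) → ∑ (λ i → f (m ∸ suc i)) (upTo m) ≡ ∑ f (upTo m)
∑-upTo-reverse zero    f = refl
∑-upTo-reverse (suc m) f = begin
  ∑ (λ i → f (suc m ∸ suc i)) (upTo (suc m))  ≡⟨ ∑-upTo-suc m (λ i → f (suc m ∸ suc i)) ⟩
  f m + ∑ (λ i → f (m ∸ suc i)) (upTo m)      ≡⟨ cong (f m +_) (∑-upTo-reverse m f) ⟩
  f m + ∑ f (upTo m)                          ≡⟨ +-comm (f m) _ ⟩
  ∑ f (upTo m) + f m                          ≡⟨ ∑-upTo-∷ʳ m f ⟨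
  ∑ f (upTo (suc m))                          ∎
  where open ≡-Reasoning

∑-upTo-+ : ∀ a b (f : ℕ → ℕ) → ∑ f (upTo (a + b)) ≡ ∑ f (upTo a) + ∑ (λ i → f (a + i)) (upTo b)
∑-upTo-+ a zero    f rewrite +-identityʳ a = sym (+-identityʳ _)
∑-upTo-+ a (suc b) f rewrite ℕₚ.+-suc a b = begin
  ∑ f (upTo (suc (a + b)))
    ≡⟨ ∑-upTo-∷ʳ (a + b) f ⟩
  ∑ f (upTo (a + b)) + f (a + b)
    ≡⟨ cong (_+ f (a + b)) (∑-upTo-+ a b f) ⟩
  ∑ f (upTo a) + ∑ (λ i → f (a + i)) (upTo b) + f (a + b)
    ≡⟨ +-assoc (∑ f (upTo a)) _ _ ⟩
  ∑ f (upTo a) + (∑ (λ i → f (a + i)) (upTo b) + f (a + b))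
    ≡⟨ cong (∑ f (upTo a) +_) (∑-upTo-∷ʳ b (λ i → f (a + i))) ⟨
  ∑ f (upTo a) + ∑ (λ i → f (a + i)) (upTo (suc b)) ∎
  where open ≡-Reasoning

∑-code-signedValsʳ : ∀ m p (f : ℕ → ℕ) →
                     ∑ (f ∘ code m) (signedValsʳ p) ≡ ∑ (λ i → f (m ∸ suc i) + f (m + i)) (upTo p)
∑-code-signedValsʳ m zero    f = refl
∑-code-signedValsʳ m (suc p) f =
  trans (∑-++ (f ∘ code m) (signedValsʳ p) (⁺ suc p ∷ -[1+ p ] ∷ []))
 (trans (cong₂ _+_ (∑-code-signedValsʳ m p f) (cong (f (m ∸ suc p) +_) (+-identityʳ _)))
        (sym (∑-upTo-∷ʳ p (λ i → f (m ∸ suc i) + f (m + i)))))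

∑-code : ∀ m (f : ℕ → ℕ) → ∑ (f ∘ code m) (signedValsʳ m) ≡ ∑ f (upTo (2 * m))
∑-code m f = begin
  ∑ (f ∘ code m) (signedValsʳ m)
    ≡⟨ ∑-code-signedValsʳ m m f ⟩
  ∑ (λ i → f (m ∸ suc i) + f (m + i)) (upTo m)
    ≡⟨ ∑-+ (λ i → f (m ∸ suc i)) (λ i → f (m + i)) (upTo m) ⟩
  ∑ (λ i → f (m ∸ suc i)) (upTo m) + ∑ (λ i → f (m + i)) (upTo m)
    ≡⟨ cong (_+ ∑ (λ i → f (m + i)) (upTo m)) (∑-upTo-reverse m f) ⟩
  ∑ f (upTo m) + ∑ (λ i → f (m + i)) (upTo m)
    ≡⟨ ∑-upTo-+ m m f ⟨
  ∑ f (upTo (m + m))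
    ≡⟨ cong (λ t → ∑ f (upTo (m + t))) (+-identityʳ m) ⟨
  ∑ f (upTo (2 * m)) ∎
  where open ≡-Reasoning

-- a/n < j/(n+1), cleared of denominators, when j lies in the lower half [0, n] ...
*-suc-<-*⇔<ˡ : ∀ {a j n} → j ≤ n → (a * suc n < j * n) ⇔ (a < j)
*-suc-<-*⇔<ˡ {a} {j} {n} j≤n = mk⇔ to from
  where
  open ℕₚ.≤-Reasoning
  to : a * suc n < j * n → a < j
  to lt = ℕₚ.≰⇒> λ j≤a → ℕₚ.<⇒≱ lt (begin
    j * n      ≤⟨ ℕₚ.*-monoʳ-≤ j (ℕₚ.n≤1+n n) ⟩
    j * suc n  ≤⟨ ℕₚ.*-monoˡ-≤ (suc n) j≤a ⟩
    a * suc n  ∎)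
  from : a < j → a * suc n < j * n
  from a<j = begin-strict
    a * suc n  ≡⟨ ℕₚ.*-suc a n ⟩
    a + a * n  <⟨ ℕₚ.+-monoˡ-< (a * n) (ℕₚ.<-≤-trans a<j j≤n) ⟩
    suc a * n  ≤⟨ ℕₚ.*-monoˡ-≤ n a<j ⟩
    j * n      ∎

-- ... and when j = n + 1 + k lies in the upper half.
*-suc-<-*⇔<ʳ : ∀ {a k n} → k ≤ n → (a * suc n < (suc n + k) * n) ⇔ (a < n + k)
*-suc-<-*⇔<ʳ {a} {k} {n} k≤n = mk⇔ to from
  where
  open ℕₚ.≤-Reasoning
  to : a * suc n < (suc n + k) * n → a < n + k
  to lt = ℕₚ.≰⇒> λ n+k≤a → ℕₚ.<⇒≱ lt (begin
    n + (n + k) * n            ≤⟨ ℕₚ.+-monoˡ-≤ ((n + k) * n) (ℕₚ.m≤m+n n k) ⟩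
    n + k + (n + k) * n        ≡⟨ ℕₚ.*-suc (n + k) n ⟨
    (n + k) * suc n            ≤⟨ ℕₚ.*-monoˡ-≤ (suc n) n+k≤a ⟩
    a * suc n                  ∎)
  from : a < n + k → a * suc n < (suc n + k) * n
  from a<n+k = ℕₚ.+-cancelˡ-≤ n _ _ (begin
    n + suc (a * suc n)          ≡⟨ ℕₚ.+-suc n (a * suc n) ⟩
    suc a * suc n                ≤⟨ ℕₚ.*-monoˡ-≤ (suc n) a<n+k ⟩
    (n + k) * suc n              ≡⟨ ℕₚ.*-suc (n + k) n ⟩
    n + k + (n + k) * n          ≤⟨ ℕₚ.+-monoˡ-≤ ((n + k) * n) (ℕₚ.+-monoʳ-≤ n k≤n) ⟩
    n + n + (n + k) * n          ≡⟨ +-assoc n n ((n + k) * n) ⟩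
    n + (suc n + k) * n          ∎)

<-punchIn⇔≤ : ∀ {k i} → (k < punchIn k i) ⇔ (k ≤ i)
<-punchIn⇔≤ {k} {i} = mk⇔ to (λ k≤i → subst (k <_) (sym (punchIn-≥ k≤i)) (s≤s k≤i))
  where
  to : k < punchIn k i → k ≤ i
  to lt with k ℕ.≤? i
  ... | yes k≤i = k≤i
  ... | no  k≰i = ⊥-elim (ℕₚ.<-asym (ℕₚ.≰⇒> k≰i) lt)

punchIn-<⇔< : ∀ {k i} → (punchIn k i < k) ⇔ (i < k)
punchIn-<⇔< {k} {i} = mk⇔ to (λ i<k → subst (_< k) (sym (punchIn-< i<k)) i<k)
  where
  to : punchIn k i < k → i < k
  to lt with i ℕ.<? k
  ... | yes i<k = i<k
  ... | no  i≮k = ⊥-elim (ℕₚ.<⇒≱ (subst (_< k) (punchIn-≥ k≤i) lt) (ℕₚ.m≤n⇒m≤1+n k≤i))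
    where
    k≤i : k ≤ i
    k≤i = ℕₚ.≮⇒≥ i≮k

negative⇔excedance : ∀ n {v} → Signed (suc n) v → (v ℤ.< ⁺ 0) ⇔ (suc n ≤ code (suc n) v)
negative⇔excedance n (pos {k} _) =
  mk⇔ (λ { (+<+ ()) }) (λ n<n∸k → ⊥-elim (ℕₚ.<-irrefl refl (ℕₚ.<-≤-trans n<n∸k (ℕₚ.m∸n≤m n k))))
negative⇔excedance n (negsuc {k} _) = mk⇔ (λ _ → ℕₚ.m≤m+n (suc n) k) (λ _ → -<+)

-- With u the last entry of the standardised prefix and v the new last entry: a descent at
-- position n becomes the ascent e_n/n < e_{n+1}/(n+1).
descent⇔ascent : ∀ n {u v} → Signed n u → Signed (suc n) v →
                 (v ℤ.< punchInℤ (ℕ.pred ∣ v ∣) u) ⇔ (code n u * suc n < code (suc n) v * n)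
descent⇔ascent n (pos {i} i<n) (pos {k} k≤n) =
  ⇔-sym (*-suc-<-*⇔<ˡ (ℕₚ.m∸n≤m n k))
    ⇔-∘ (mk⇔ (λ k≤i → ℕₚ.∸-monoʳ-< (s≤s k≤i) i<n) (ℕₚ.≤-pred ∘ ℕₚ.∸-cancelʳ-<)
    ⇔-∘ (<-punchIn⇔≤
    ⇔-∘ mk⇔ (λ { (+<+ (s≤s lt)) → lt }) (+<+ ∘ s≤s)))
descent⇔ascent n (negsuc {i} _) (pos {k} _) =
  mk⇔ (λ ()) (λ lt → ⊥-elim (ℕₚ.<⇒≱ (Equivalence.to (*-suc-<-*⇔<ˡ (ℕₚ.m∸n≤m n k)) lt)
                                   (ℕₚ.≤-trans (ℕₚ.m∸n≤m n k) (ℕₚ.m≤m+n n i))))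
descent⇔ascent n (pos {i} i<n) (negsuc {k} k≤n) =
  mk⇔ (λ _ → Equivalence.from (*-suc-<-*⇔<ʳ (ℕₚ.≤-pred k≤n))
                (ℕₚ.<-≤-trans (ℕₚ.∸-monoʳ-< {o = 0} ℕ.z<s i<n) (ℕₚ.m≤m+n n k)))
      (λ _ → -<+)
descent⇔ascent n (negsuc {i} _) (negsuc {k} k≤n) =
  ⇔-sym (*-suc-<-*⇔<ʳ (ℕₚ.≤-pred k≤n))
    ⇔-∘ (mk⇔ (ℕₚ.+-monoʳ-< n) (ℕₚ.+-cancelˡ-< n i k)
    ⇔-∘ (punchIn-<⇔<
    ⇔-∘ mk⇔ (λ { (-<- lt) → lt }) -<-))

-- Generating sums refined by the last entry

Weight : Set
Weight = ℕ → ℕ → ℕ → ℕ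

refinedB : ℕ → Weight → ℕ
refinedB n G = ∑ (λ σ → ⟦ isSignedPerm? σ ⟧ * G (code n (lastOr (⁺ 0) σ)) (neg σ) (desD σ))
                 (words n (signedValsʳ n))

refinedI : ℕ → Weight → ℕ
refinedI n G = ∑ (λ e → G (lastOr 0 e) (exc e) (ascD e)) (I n)

-- Both refined sums pass from n to n + 1 by this transformation of the weight.
extend : ℕ → Weight → Weight
extend n G e x y = ∑ (λ j → G j (x + ⟦ suc n ℕ.≤? j ⟧) (y + ⟦ e * suc n ℕ.<? j * n ⟧)) (upTo (2 * suc n))

refinedI-suc : ∀ m G → refinedI (3 + m) G ≡ refinedI (2 + m) (extend (2 + m) G)
refinedI-suc m G =
  trans (∑-I-suc (2 + m) _) (∑-I-cong (2 + m) (λ e ∣e∣≡n → ∑-cong (upTo (2 * (3 + m))) (appendEntry e ∣e∣≡n)))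
  where
  appendEntry : ∀ e → length e ≡ 2 + m → ∀ j →
    G (lastOr 0 (e ∷ʳ j)) (exc (e ∷ʳ j)) (ascD (e ∷ʳ j)) ≡
    G j (exc e + ⟦ 3 + m ℕ.≤? j ⟧) (ascD e + ⟦ lastOr 0 e * (3 + m) ℕ.<? j * (2 + m) ⟧)
  appendEntry (x ∷ y ∷ e) refl j
    rewrite lastOr-∷ʳ 0 (x ∷ y ∷ e) j | excFrom-∷ʳ 1 (x ∷ y ∷ e) j | ascD-∷ʳ x y e j = refl

∑-isSignedPerm-∷ʳ : (m : ℕ) (f : List ℤ → ℕ) (xs : List ℤ) →
  ∑ (λ σ → ⟦ isSignedPerm? σ ⟧ * f σ) (words (suc m) xs) ≡
  ∑ (λ w → ∑ (λ v → ⟦ all? (avoids? ∣ v ∣) w ⟧ * (⟦ isSignedPerm? w ⟧ * f (w ∷ʳ v))) xs) (words m xs)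
∑-isSignedPerm-∷ʳ m f xs =
  trans (∑-words-∷ʳ m _ xs) (∑-cong (words m xs) (λ w → ∑-cong xs (λ v → begin
    ⟦ isSignedPerm? (w ∷ʳ v) ⟧ * f (w ∷ʳ v)
      ≡⟨ cong (_* f (w ∷ʳ v)) (⟦isSignedPerm?⟧-∷ʳ w v) ⟩
    ⟦ isSignedPerm? w ⟧ * ⟦ all? (avoids? ∣ v ∣) w ⟧ * f (w ∷ʳ v)
      ≡⟨ reassoc ⟦ isSignedPerm? w ⟧ _ _ ⟩
    ⟦ all? (avoids? ∣ v ∣) w ⟧ * (⟦ isSignedPerm? w ⟧ * f (w ∷ʳ v)) ∎)))
  where
  open ≡-Reasoning
  reassoc : ∀ a b c → a * b * c ≡ b * (a * c)
  reassoc = solve-∀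

∑-words-avoiding : ∀ m n k → k ≤ n → (f : List ℤ → ℕ) →
  ∑ (λ w → ⟦ all? (avoids? (suc k)) w ⟧ * f w) (words m (signedValsʳ (suc n))) ≡
  ∑ (f ∘ map (punchInℤ k)) (words m (signedValsʳ n))
∑-words-avoiding m n k k≤n f =
  trans (∑-words-filter (avoids? (suc k)) m f (signedValsʳ (suc n)))
 (trans (cong (λ xs → ∑ f (words m xs)) (filter-avoids-signedValsʳ n k k≤n))
        (∑-words-map m f (punchInℤ k) (signedValsʳ n)))

∑-last-entry : ∀ n G {u} → Signed n u → ∀ x y →
  ∑ (λ v → G (code (suc n) v) (x + ⟦ v ℤ.<? ⁺ 0 ⟧) (y + ⟦ v ℤ.<? punchInℤ (ℕ.pred ∣ v ∣) u ⟧)) (signedValsʳ (suc n))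
  ≡ extend n G (code n u) x y
∑-last-entry n G {u} su x y =
  trans (∑-cong-All (All-Signed-signedValsʳ (suc n)) (λ v sv →
           cong₂ (G (code (suc n) v))
                 (cong (x +_) (⟦⟧-cong (_ ℤ.<? _) (_ ℕ.≤? _) (negative⇔excedance n sv)))
                 (cong (y +_) (⟦⟧-cong (_ ℤ.<? _) (_ ℕ.<? _) (descent⇔ascent n su sv)))))
        (∑-code (suc n) (λ j → G j (x + ⟦ suc n ℕ.≤? j ⟧) (y + ⟦ code n u * suc n ℕ.<? j * n ⟧)))

refinedB-suc : ∀ m G → refinedB (3 + m) G ≡ refinedB (2 + m) (extend (2 + m) G)
refinedB-suc m G = begin
  refinedB (suc n) G
    ≡⟨ ∑-isSignedPerm-∷ʳ n f ±[ suc n ] ⟩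
  ∑ (λ w → ∑ (λ v → ⟦ all? (avoids? ∣ v ∣) w ⟧ * (U w * f (w ∷ʳ v))) ±[ suc n ]) (words n ±[ suc n ])
    ≡⟨ ∑-words-cong-All (All-Signed-signedValsʳ (suc n)) n (λ w _ ∣w∣≡n → ∑-cong ±[ suc n ] λ v →
         cong (λ t → ⟦ all? (avoids? ∣ v ∣) w ⟧ * (U w * t)) (appendEntry w ∣w∣≡n v)) ⟩
  ∑ (λ w → ∑ (λ v → ⟦ all? (avoids? ∣ v ∣) w ⟧ * (U w * H v w)) ±[ suc n ]) (words n ±[ suc n ])
    ≡⟨ ∑-comm (λ w v → ⟦ all? (avoids? ∣ v ∣) w ⟧ * (U w * H v w)) (words n ±[ suc n ]) ±[ suc n ] ⟩
  ∑ (λ v → ∑ (λ w → ⟦ all? (avoids? ∣ v ∣) w ⟧ * (U w * H v w)) (words n ±[ suc n ])) ±[ suc n ]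
    ≡⟨ ∑-cong-All (All-Signed-signedValsʳ (suc n)) standardise ⟩
  ∑ (λ v → ∑ (λ τ → U τ * H′ (ℕ.pred ∣ v ∣) v τ) (words n ±[ n ])) ±[ suc n ]
    ≡⟨ ∑-comm (λ τ v → U τ * H′ (ℕ.pred ∣ v ∣) v τ) (words n ±[ n ]) ±[ suc n ] ⟨
  ∑ (λ τ → ∑ (λ v → U τ * H′ (ℕ.pred ∣ v ∣) v τ) ±[ suc n ]) (words n ±[ n ])
    ≡⟨ ∑-words-cong-All (All-Signed-signedValsʳ n) n lastEntry ⟩
  refinedB n (extend n G) ∎
  where
  open ≡-Reasoning
  n : ℕ
  n = 2 + m
  ±[_] : ℕ → List ℤ
  ±[_] = signedValsʳ
  U : List ℤ → ℕ
  U σ = ⟦ isSignedPerm? σ ⟧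
  f : List ℤ → ℕ
  f σ = G (code (suc n) (lastOr (⁺ 0) σ)) (neg σ) (desD σ)
  H : ℤ → List ℤ → ℕ
  H v w = G (code (suc n) v) (neg w + ⟦ v ℤ.<? ⁺ 0 ⟧) (desD w + ⟦ v ℤ.<? lastOr (⁺ 0) w ⟧)
  H′ : ℕ → ℤ → List ℤ → ℕ
  H′ k v τ = G (code (suc n) v) (neg τ + ⟦ v ℤ.<? ⁺ 0 ⟧) (desD τ + ⟦ v ℤ.<? punchInℤ k (lastOr (⁺ 0) τ) ⟧)

  appendEntry : ∀ w → length w ≡ n → ∀ v → f (w ∷ʳ v) ≡ H v w
  appendEntry (x ∷ y ∷ w) refl v
    rewrite lastOr-∷ʳ (⁺ 0) (x ∷ y ∷ w) v | neg-∷ʳ (x ∷ y ∷ w) v | desD-∷ʳ x y w v = refl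

  standardise′ : ∀ k v → k ≤ n →
    ∑ (λ w → ⟦ all? (avoids? (suc k)) w ⟧ * (U w * H v w)) (words n ±[ suc n ]) ≡
    ∑ (λ τ → U τ * H′ k v τ) (words n ±[ n ])
  standardise′ k v k≤n =
    trans (∑-words-avoiding n n k k≤n (λ w → U w * H v w))
          (∑-cong (words n ±[ n ]) λ τ → cong₂ _*_ (⟦isSignedPerm?⟧-punchInℤ k τ)
            (cong₂ (G (code (suc n) v)) (cong (_+ ⟦ v ℤ.<? ⁺ 0 ⟧) (neg-punchInℤ k τ))
              (cong₂ _+_ (desD-punchInℤ k τ) (cong (⟦_⟧ ∘ (v ℤ.<?_)) (lastOr-map (punchInℤ k) (⁺ 0) τ)))))

  standardise : ∀ v → Signed (suc n) v →
    ∑ (λ w → ⟦ all? (avoids? ∣ v ∣) w ⟧ * (U w * H v w)) (words n ±[ suc n ]) ≡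
    ∑ (λ τ → U τ * H′ (ℕ.pred ∣ v ∣) v τ) (words n ±[ n ])
  standardise v (pos k<n+1)    = standardise′ _ v (ℕₚ.≤-pred k<n+1)
  standardise v (negsuc k<n+1) = standardise′ _ v (ℕₚ.≤-pred k<n+1)

  lastEntry : ∀ τ → All (Signed n) τ → length τ ≡ n →
    ∑ (λ v → U τ * H′ (ℕ.pred ∣ v ∣) v τ) ±[ suc n ] ≡ U τ * extend n G (code n (lastOr (⁺ 0) τ)) (neg τ) (desD τ)
  lastEntry (a ∷ τ) (sa ∷ sτ) _ =
    trans (∑-*ˡ (U (a ∷ τ)) (λ v → H′ (ℕ.pred ∣ v ∣) v (a ∷ τ)) ±[ suc n ])
          (cong (U (a ∷ τ) *_) (∑-last-entry n G (lastOr-All sa sτ) (neg (a ∷ τ)) (desD (a ∷ τ))))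

-- Both sides evaluate to the eight weights of B₂ ≅ I₂, listed in different orders.
refinedB₂≡refinedI₂ : ∀ G → refinedB 2 G ≡ refinedI 2 G
refinedB₂≡refinedI₂ G =
  reorder (G 0 0 0) (G 1 0 1) (G 2 1 1) (G 3 1 2) (G 0 1 0) (G 1 1 1) (G 2 2 1) (G 3 2 2)
  where
  reorder : ∀ a b c d e f g h →
            b + 0 + (f + 0 + (c + 0 + (g + 0 + (a + 0 + (e + 0 + (d + 0 + (h + 0 + 0))))))) ≡
            a + (b + (c + (d + (e + (f + (g + (h + 0)))))))
  reorder = solve-∀

refinedB≡refinedI : ∀ m G → refinedB (2 + m) G ≡ refinedI (2 + m) G
refinedB≡refinedI zero    G = refinedB₂≡refinedI₂ G
refinedB≡refinedI (suc m) G = begin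
  refinedB (3 + m) G                      ≡⟨ refinedB-suc m G ⟩
  refinedB (2 + m) (extend (2 + m) G)     ≡⟨ refinedB≡refinedI m (extend (2 + m) G) ⟩
  refinedI (2 + m) (extend (2 + m) G)     ≡⟨ refinedI-suc m G ⟨
  refinedI (3 + m) G                      ∎
  where open ≡-Reasoning

coefficient : ℕ → ℕ → Weight
coefficient a b _ x y = ⟦ (x ℕ.≟ a) ×-dec (y ℕ.≟ b) ⟧

coeffB≡refinedB : ∀ n a b → coeffB n a b ≡ refinedB n (coefficient a b)
coeffB≡refinedB n a b = begin
  length (filter Q? (B n))
    ≡⟨ length≡∑1 (filter Q? (B n)) ⟩
  ∑ (λ _ → 1) (filter Q? (B n))
    ≡⟨ ∑-filter Q? (λ _ → 1) (B n) ⟩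
  ∑ (λ σ → ⟦ Q? σ ⟧ * 1) (B n)
    ≡⟨ ∑-filter isSignedPerm? (λ σ → ⟦ Q? σ ⟧ * 1) (words n (signedVals n)) ⟩
  ∑ (λ σ → ⟦ isSignedPerm? σ ⟧ * (⟦ Q? σ ⟧ * 1)) (words n (signedVals n))
    ≡⟨ cong (λ xs → ∑ (λ σ → ⟦ isSignedPerm? σ ⟧ * (⟦ Q? σ ⟧ * 1)) (words n xs)) (signedVals≡signedValsʳ n) ⟩
  ∑ (λ σ → ⟦ isSignedPerm? σ ⟧ * (⟦ Q? σ ⟧ * 1)) (words n (signedValsʳ n))
    ≡⟨ ∑-cong (words n (signedValsʳ n)) (λ σ → cong (⟦ isSignedPerm? σ ⟧ *_) (*-identityʳ ⟦ Q? σ ⟧)) ⟩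
  refinedB n (coefficient a b) ∎
  where
  open ≡-Reasoning
  Q? : (σ : List ℤ) → Dec (neg σ ≡ a × desD σ ≡ b)
  Q? σ = (neg σ ℕ.≟ a) ×-dec (desD σ ℕ.≟ b)

coeffI≡refinedI : ∀ n a b → coeffI n a b ≡ refinedI n (coefficient a b)
coeffI≡refinedI n a b =
  trans (length≡∑1 (filter Q? (I n)))
 (trans (∑-filter Q? (λ _ → 1) (I n)) (∑-cong (I n) (λ e → *-identityʳ ⟦ Q? e ⟧)))
  where
  Q? : (e : List ℕ) → Dec (exc e ≡ a × ascD e ≡ b)
  Q? e = (exc e ℕ.≟ a) ×-dec (ascD e ℕ.≟ b)

lemma3p2 : (n : ℕ) → 2 ≤ n → (a b : ℕ) → coeffB n a b ≡ coeffI n a b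
lemma3p2 (suc (suc m)) (s≤s (s≤s _)) a b = begin
  coeffB (2 + m) a b                      ≡⟨ coeffB≡refinedB (2 + m) a b ⟩
  refinedB (2 + m) (coefficient a b)      ≡⟨ refinedB≡refinedI m (coefficient a b) ⟩
  refinedI (2 + m) (coefficient a b)      ≡⟨ coeffI≡refinedI (2 + m) a b ⟨
  coeffI (2 + m) a b                      ∎
  where open ≡-Reasoning
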